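{- Let $x\ge3$ and set $y=2\log x$. Then, with absolute implied constants: (a) $\displaystyle \sum_{\substack{m > x^{1/2} \\ m \text{ is } y\text{ -friable}}} \frac1m = O(x^{ -1/3})$; (b) the number of positive integers less than $x$ that have a $y$-friable divisor exceeding $x^{1/2}$ is $O(x^{2/3})$.
   Context: A positive integer $m$ is $y$-friable if every prime factor of $m$ is at most $y$ (so $m=1$ is $y$-friable).
   Formalization: The parameter $x$ is taken over the rationals. -}

module Defs where

open import Data.Nat as ℕ using (ℕ; zero; suc)
open import Data.Nat.Divisibility using (_∣_)
open import Data.Nat.Primality using (Prime)
open import Data.Integer using (+_)
open import Data.Rational using (ℚ; 0ℚ; 1ℚ; _+_; _*_; _/_; _≤_; _<_)
open import Data.List using (List; []; _∷_)

toℚ : ℕ → ℚ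
toℚ n = + n / 1

expTerm : ℕ → ℕ → ℚ
expTerm p zero    = 1ℚ
expTerm p (suc k) = expTerm p k * (+ p / suc k)

expPartial : ℕ → ℕ → ℚ
expPartial p zero    = 1ℚ
expPartial p (suc n) = expPartial p n + expTerm p (suc n)

-- e^p ≤ x² (equivalently p ≤ 2 log x, for x > 0):
-- e^p is the supremum of the partial sums of its exponential series.
ExpLe : ℕ → ℚ → Set
ExpLe p x = ∀ n → expPartial p n ≤ x * x

Friable2logx : ℚ → ℕ → Set
Friable2logx x m = ∀ p → Prime p → p ∣ m → ExpLe p x

-- 1/m (with 1/0 := 0, never used on m = 0)
recip : ℕ → ℚ
recip zero    = 0ℚ
recip (suc k) = + 1 / suc k

sumRecip : List ℕ → ℚ
sumRecip []       = 0ℚ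
sumRecip (m ∷ ms) = recip m + sumRecip ms

cube : ℚ → ℚ
cube q = q * q * q

AboveSqrt : ℚ → ℕ → Set
AboveSqrt x m = x < toℚ m * toℚ m

module Submission where

-- Rankin's trick.  If every m is N-friable and r ≤ m^{3/4}, then
--   r Σ 1/m ≤ Σ m^{-1/4} ≤ ∏_{2 ≤ p ≤ N} (1 - c_p)^{-1}   whenever c_p ≥ p^{-1/4}.
-- With c_p = 7/8 below 10^8 and c_p = 1/100 above, the 48th power of the product is at most
-- K · 2^N, and a prime p with e^p ≤ x² has 2^{p-1} ≤ p^p/p! ≤ x², so N can be taken with 2^N ≤ 2x².
-- For m > x^{1/2} one may take r ≈ x^{3/8}, giving (Σ 1/m)^48 · x^18 ≪ x², i.e. Σ 1/m ≪ x^{-1/3}.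
-- For (b), the count is at most Σ_d x/d over the distinct friable divisors d > x^{1/2}
-- that occur, which is x times a sum of the kind bounded in (a).

open import Defs

open import Algebra.Bundles using (CommutativeRing)
open import Data.Bool using (true; false)
open import Data.Empty using (⊥-elim)
open import Data.Integer as ℤ using (+_; -[1+_])
import Data.Integer.Properties as ℤ
import Data.Integer.Solver as ℤ-Solver
open import Data.List using (List; []; _∷_; length; map; filter; deduplicate)
open import Data.List.Extrema.Nat using (max; xs≤max; argmax-all)
open import Data.List.Membership.Propositional using (_∈_)
open import Data.List.Membership.Propositional.Properties using (∈-deduplicate⁺)
open import Data.List.Properties using (length-map)
open import Data.List.Relation.Unary.All as All using (All; []; _∷_)
import Data.List.Relation.Unary.All.Properties as All
open import Data.List.Relation.Unary.AllPairs using ([]; _∷_)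
open import Data.List.Relation.Unary.Any using (here; there)
open import Data.List.Relation.Unary.Unique.Propositional using (Unique)
open import Data.Nat as ℕ using (ℕ; zero; suc; z≤n; s≤s)
import Data.Nat.Properties as ℕ
open import Data.Nat.Coprimality using (1-coprimeTo) renaming (sym to coprime-sym)
open import Data.Nat.Divisibility using (_∣_; _∣?_; divides; ∣-trans; m∣m*n; 0∣⇒≡0)
open import Data.Nat.ListAction.Properties using (∈⇒∣product)
open import Data.Nat.Primality using (Prime; prime⇒nonTrivial)
open import Data.Nat.Primality.Factorisation using (factorise)
import Data.Nat.Solver as ℕ-Solver
open import Data.Product using (Σ; _×_; _,_; proj₁; ∃)
open import Data.Rational
open import Data.Rational.Properties
import Data.Rational.Solver as ℚ-Solver
import Data.Rational.Unnormalised as ℚᵘ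
import Data.Rational.Unnormalised.Properties as ℚᵘ
open import Data.Sum using (inj₁; inj₂)
open import Function using (id)
open import Level using (0ℓ)
open import Relation.Binary.PropositionalEquality
open import Relation.Nullary using (¬_; yes; no; does)
open import Relation.Unary using (Pred; Decidable)
open import Relation.Unary.Properties using (∁?)

import Data.List.Relation.Unary.Unique.DecPropositional.Properties (ℕ._≟_) as Uniq
open import Algebra.Properties.CommutativeSemiring.Exp
  (CommutativeRing.commutativeSemiring +-*-commutativeRing)
  using (_^_; ^-assocʳ; ^-distrib-*)

toℚ≡mkℚ : ∀ n → toℚ n ≡ mkℚ (+ n) 0 (coprime-sym (1-coprimeTo n))
toℚ≡mkℚ n = normalize-coprime (coprime-sym (1-coprimeTo n))

/-≡ : ∀ a b c d → a ℤ.* + suc d ≡ c ℤ.* + suc b → a / suc b ≡ c / suc d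
/-≡ a b c d eq = fromℚᵘ-cong {ℚᵘ.mkℚᵘ a b} {ℚᵘ.mkℚᵘ c d} (ℚᵘ.*≡* eq)

toℚ-+ : ∀ m n → toℚ (m ℕ.+ n) ≡ toℚ m + toℚ n
toℚ-+ m n rewrite toℚ≡mkℚ m | toℚ≡mkℚ n =
  /-≡ (+ (m ℕ.+ n)) 0 (+ m ℤ.* + 1 ℤ.+ + n ℤ.* + 1) 0
    (cong (ℤ._* + 1) (sym (cong₂ ℤ._+_ (ℤ.*-identityʳ (+ m)) (ℤ.*-identityʳ (+ n)))))

toℚ-* : ∀ m n → toℚ (m ℕ.* n) ≡ toℚ m * toℚ n
toℚ-* m n rewrite toℚ≡mkℚ m | toℚ≡mkℚ n | ℤ.+◃n≡+n (m ℕ.* n) = refl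

toℚ-^ : ∀ m k → toℚ (m ℕ.^ k) ≡ toℚ m ^ k
toℚ-^ m zero    = refl
toℚ-^ m (suc k) = trans (toℚ-* m (m ℕ.^ k)) (cong (toℚ m *_) (toℚ-^ m k))

toℚ-mono-≤ : ∀ {m n} → m ℕ.≤ n → toℚ m ≤ toℚ n
toℚ-mono-≤ {m} {n} m≤n rewrite toℚ≡mkℚ m | toℚ≡mkℚ n =
  *≤* (subst₂ ℤ._≤_ (sym (ℤ.*-identityʳ (+ m))) (sym (ℤ.*-identityʳ (+ n))) (ℤ.+≤+ m≤n))

toℚ-mono-< : ∀ {m n} → m ℕ.< n → toℚ m < toℚ n
toℚ-mono-< {m} {n} m<n rewrite toℚ≡mkℚ m | toℚ≡mkℚ n =
  *<* (subst₂ ℤ._<_ (sym (ℤ.*-identityʳ (+ m))) (sym (ℤ.*-identityʳ (+ n))) (ℤ.+<+ m<n))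

toℚ-nonNeg : ∀ n → 0ℚ ≤ toℚ n
toℚ-nonNeg n = toℚ-mono-≤ {0} {n} z≤n

toℚ-pos : ∀ {n} → 1 ℕ.≤ n → 0ℚ < toℚ n
toℚ-pos {n} = toℚ-mono-< {0} {n}

recip-inverse : ∀ k → recip (suc k) * toℚ (suc k) ≡ 1ℚ
recip-inverse k rewrite normalize-coprime (1-coprimeTo (suc k)) | toℚ≡mkℚ (suc k) =
  /-≡ (+ 1 ℤ.* + suc k) (k ℕ.* 1) (+ 1) 0
    (trans (ℤ.*-identityʳ _) (trans (ℤ.*-identityˡ _)
      (sym (trans (ℤ.*-identityˡ _) (cong (λ j → + suc j) (ℕ.*-identityʳ k))))))

/-*-cancel : ∀ p k → (+ p / suc k) * toℚ (suc k) ≡ toℚ p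
/-*-cancel p k = toℚᵘ-injective (ℚᵘ.≃-trans (toℚᵘ-homo-* (+ p / suc k) (toℚ (suc k)))
  (ℚᵘ.≃-trans (ℚᵘ.*-cong (toℚᵘ-fromℚᵘ (ℚᵘ.mkℚᵘ (+ p) k))
                         (ℚᵘ.≃-reflexive (cong toℚᵘ (toℚ≡mkℚ (suc k)))))
  (ℚᵘ.≃-trans (ℚᵘ.*≡* (solve 2 (λ a b → a :* b :* con (+ 1) := a :* (b :* con (+ 1)))
                                refl (+ p) (+ suc k)))
  (ℚᵘ.≃-reflexive (cong toℚᵘ (sym (toℚ≡mkℚ p)))))))
  where open ℤ-Solver.+-*-Solver

recip-nonNeg : ∀ m → 0ℚ ≤ recip m
recip-nonNeg zero    = ≤-refl
recip-nonNeg (suc k) = nonNegative⁻¹ _ {{normalize-nonNeg 1 (suc k)}}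

sumRecip-nonNeg : ∀ ms → 0ℚ ≤ sumRecip ms
sumRecip-nonNeg []       = ≤-refl
sumRecip-nonNeg (m ∷ ms) = +-mono-≤ (recip-nonNeg m) (sumRecip-nonNeg ms)

*-nonNeg : ∀ {a b} → 0ℚ ≤ a → 0ℚ ≤ b → 0ℚ ≤ a * b
*-nonNeg {a} {b} 0≤a 0≤b = nonNegative⁻¹ (a * b)
  {{nonNeg*nonNeg⇒nonNeg a {{nonNegative 0≤a}} b {{nonNegative 0≤b}}}}

*-pos : ∀ {a b} → 0ℚ < a → 0ℚ < b → 0ℚ < a * b
*-pos {a} {b} 0<a 0<b = positive⁻¹ (a * b) {{pos*pos⇒pos a {{positive 0<a}} b {{positive 0<b}}}}

*-monoˡ-≤ : ∀ c {a b} → 0ℚ ≤ c → a ≤ b → c * a ≤ c * b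
*-monoˡ-≤ c 0≤c = *-monoˡ-≤-nonNeg c {{nonNegative 0≤c}}

*-monoʳ-≤ : ∀ c {a b} → 0ℚ ≤ c → a ≤ b → a * c ≤ b * c
*-monoʳ-≤ c 0≤c = *-monoʳ-≤-nonNeg c {{nonNegative 0≤c}}

*-mono-≤ : ∀ {a b c d} → 0ℚ ≤ a → 0ℚ ≤ c → a ≤ b → c ≤ d → a * c ≤ b * d
*-mono-≤ {a} {b} {c} 0≤a 0≤c a≤b c≤d =
  ≤-trans (*-monoʳ-≤ c 0≤c a≤b) (*-monoˡ-≤ b (≤-trans 0≤a a≤b) c≤d)

*-cancelʳ-≤ : ∀ c {a b} → 0ℚ < c → a * c ≤ b * c → a ≤ b
*-cancelʳ-≤ c 0<c = *-cancelʳ-≤-pos c {{positive 0<c}}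

0ℚ<1ℚ : 0ℚ < 1ℚ
0ℚ<1ℚ = *<* (ℤ.+<+ (s≤s z≤n))

^-nonNeg : ∀ {a} k → 0ℚ ≤ a → 0ℚ ≤ a ^ k
^-nonNeg zero    0≤a = ≤ᵇ⇒≤ _
^-nonNeg (suc k) 0≤a = *-nonNeg 0≤a (^-nonNeg k 0≤a)

^-pos : ∀ {a} k → 0ℚ < a → 0ℚ < a ^ k
^-pos zero    0<a = 0ℚ<1ℚ
^-pos (suc k) 0<a = *-pos 0<a (^-pos k 0<a)

^-mono-≤ : ∀ {a b} k → 0ℚ ≤ a → a ≤ b → a ^ k ≤ b ^ k
^-mono-≤ zero    0≤a a≤b = ≤-refl
^-mono-≤ (suc k) 0≤a a≤b = *-mono-≤ 0≤a (^-nonNeg k 0≤a) a≤b (^-mono-≤ k 0≤a a≤b)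

^-mono-< : ∀ {a b} k → 0ℚ ≤ a → a < b → a ^ suc k < b ^ suc k
^-mono-< {a} {b} k 0≤a a<b =
  ≤-<-trans (*-monoˡ-≤ a 0≤a (^-mono-≤ k 0≤a (<⇒≤ a<b)))
            (*-monoˡ-<-pos (b ^ k) {{positive (^-pos k (≤-<-trans 0≤a a<b))}} a<b)

^-cancel-≤ : ∀ {a b} k → 0ℚ ≤ b → a ^ suc k ≤ b ^ suc k → a ≤ b
^-cancel-≤ {a} {b} k 0≤b aᵏ≤bᵏ with a ≤? b
... | yes a≤b = a≤b
... | no  a≰b = ⊥-elim (<-irrefl refl (<-≤-trans (^-mono-< k 0≤b (≰⇒> a≰b)) aᵏ≤bᵏ))

≤-*recip : ∀ {a b d} → 1 ℕ.≤ d → a * toℚ d ≤ b → a ≤ b * recip d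
≤-*recip {a} {b} {suc k} _ ad≤b = *-cancelʳ-≤ (toℚ (suc k)) (toℚ-pos {suc k} (s≤s z≤n)) (begin
  a * toℚ (suc k)                   ≤⟨ ad≤b ⟩
  b                                 ≡⟨ *-identityʳ b ⟨
  b * 1ℚ                            ≡⟨ cong (b *_) (recip-inverse k) ⟨
  b * (recip (suc k) * toℚ (suc k)) ≡⟨ *-assoc b _ _ ⟨
  b * recip (suc k) * toℚ (suc k)   ∎)
  where open ≤-Reasoning

recip-*-cancel : ∀ k q → recip (k ℕ.* suc q) * toℚ (suc q) ≡ recip k
recip-*-cancel zero    q = *-zeroˡ (toℚ (suc q))
recip-*-cancel (suc k) q = begin
  r * Q                      ≡⟨ *-identityʳ (r * Q) ⟨
  r * Q * 1ℚ                 ≡⟨ cong (r * Q *_) (recip-inverse k) ⟨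
  r * Q * (recip K′ * K)     ≡⟨ solve 4 (λ r Q s K → r :* Q :* (s :* K) := r :* (K :* Q) :* s)
                                  refl r Q (recip K′) K ⟩
  r * (K * Q) * recip K′     ≡⟨ cong (λ w → r * w * recip K′) (toℚ-* K′ (suc q)) ⟨
  r * toℚ (K′ ℕ.* suc q) * recip K′ ≡⟨ cong (_* recip K′) (recip-inverse (q ℕ.+ k ℕ.* suc q)) ⟩
  1ℚ * recip K′              ≡⟨ *-identityˡ (recip K′) ⟩
  recip K′                   ∎
  where
  open ≡-Reasoning
  open ℚ-Solver.+-*-Solver
  K′ = suc k
  K = toℚ K′
  Q = toℚ (suc q)
  r = recip (K′ ℕ.* suc q)

sumRecip-map-* : ∀ q ks → sumRecip (map (ℕ._* suc q) ks) * toℚ (suc q) ≡ sumRecip ks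
sumRecip-map-* q []       = *-zeroˡ (toℚ (suc q))
sumRecip-map-* q (k ∷ ks) = trans (*-distribʳ-+ (toℚ (suc q)) (recip (k ℕ.* suc q)) _)
  (cong₂ _+_ (recip-*-cancel k q) (sumRecip-map-* q ks))

cube-mono-≤ : ∀ {a b} → 0ℚ ≤ a → a ≤ b → cube a ≤ cube b
cube-mono-≤ 0≤a a≤b = *-mono-≤ (*-nonNeg 0≤a 0≤a) 0≤a (*-mono-≤ 0≤a 0≤a a≤b a≤b) a≤b

≤-toℚ∣↥∣ : ∀ q → q ≤ toℚ ℤ.∣ ↥ q ∣
≤-toℚ∣↥∣ (mkℚ (+ a) d _) rewrite toℚ≡mkℚ a =
  *≤* (subst₂ ℤ._≤_ (sym (ℤ.*-identityʳ (+ a))) (ℤ.pos-* a (suc d))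
    (ℤ.+≤+ (subst (ℕ._≤ a ℕ.* suc d) (ℕ.*-identityʳ a) (ℕ.*-monoʳ-≤ a (s≤s z≤n)))))
≤-toℚ∣↥∣ q@(mkℚ -[1+ a ] d _) = ≤-trans (<⇒≤ (negative⁻¹ q)) (toℚ-nonNeg (suc a))

n<2^n : ∀ n → n ℕ.< 2 ℕ.^ n
n<2^n zero    = s≤s z≤n
n<2^n (suc n) = ℕ.≤-trans (ℕ.+-mono-≤ {1} (ℕ.m^n>0 2 n) (n<2^n n))
                          (ℕ.≤-reflexive (cong (2 ℕ.^ n ℕ.+_) (sym (ℕ.+-identityʳ _))))

m≤m^[1+k] : ∀ m k → 1 ℕ.≤ m → m ℕ.≤ m ℕ.^ suc k
m≤m^[1+k] m k 1≤m = ℕ.≤-trans (ℕ.≤-reflexive (sym (ℕ.*-identityʳ m)))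
                              (ℕ.^-monoʳ-≤ m {{ℕ.>-nonZero 1≤m}} {1} {suc k} (s≤s z≤n))

divisor-pos : ∀ {d n} → d ∣ n → 1 ℕ.≤ n → 1 ℕ.≤ d
divisor-pos {zero}  d∣n 1≤n = ⊥-elim (ℕ.<⇒≱ 1≤n (ℕ.≤-reflexive (0∣⇒≡0 d∣n)))
divisor-pos {suc _} _   _   = s≤s z≤n

-- Counting distinct elements of lists

module _ {A : Set} {P : Pred A 0ℓ} (P? : Decidable P) where

  length-filter-split : ∀ xs → length (filter P? xs) ℕ.+ length (filter (∁? P?) xs) ≡ length xs
  length-filter-split []       = refl
  length-filter-split (x ∷ xs) with does (P? x)
  ... | true  = cong suc (length-filter-split xs)
  ... | false = trans (ℕ.+-suc _ _) (cong suc (length-filter-split xs))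

module _ {P : Pred ℕ 0ℓ} (P? : Decidable P) where

  sumRecip-filter-split : ∀ ms → sumRecip (filter P? ms) + sumRecip (filter (∁? P?) ms) ≡ sumRecip ms
  sumRecip-filter-split []       = +-identityˡ 0ℚ
  sumRecip-filter-split (m ∷ ms) with does (P? m)
  ... | true  = trans (+-assoc (recip m) _ _) (cong (λ s → recip m + s) (sumRecip-filter-split ms))
  ... | false = begin
    sumRecip (filter P? ms) + (recip m + sumRecip (filter (∁? P?) ms))
      ≡⟨ solve 3 (λ a r b → a :+ (r :+ b) := r :+ (a :+ b)) refl
           (sumRecip (filter P? ms)) (recip m) (sumRecip (filter (∁? P?) ms)) ⟩
    recip m + (sumRecip (filter P? ms) + sumRecip (filter (∁? P?) ms))
      ≡⟨ cong (λ s → recip m + s) (sumRecip-filter-split ms) ⟩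
    recip m + sumRecip ms ∎
    where
    open ≡-Reasoning
    open ℚ-Solver.+-*-Solver

unique-constant⇒length≤1 : ∀ {A : Set} {c : A} xs → Unique xs → All (_≡ c) xs → length xs ℕ.≤ 1
unique-constant⇒length≤1 []          _                   _                = z≤n
unique-constant⇒length≤1 (_ ∷ [])     _                   _                = ℕ.≤-refl
unique-constant⇒length≤1 (_ ∷ _ ∷ _) ((x≢y ∷ _) ∷ _) (refl ∷ refl ∷ _) = ⊥-elim (x≢y refl)

pigeonhole : ∀ B ks → Unique ks → All (λ k → 1 ℕ.≤ k × k ℕ.≤ B) ks → length ks ℕ.≤ B
pigeonhole zero    []      _ _                = z≤n
pigeonhole zero    (_ ∷ _) _ ((1≤k , k≤0) ∷ _) = ⊥-elim (ℕ.<⇒≱ 1≤k k≤0)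
pigeonhole (suc B) ks uniq bounded = begin
  length ks                                          ≡⟨ length-filter-split (ℕ._≟ suc B) ks ⟨
  length (filter (ℕ._≟ suc B) ks) ℕ.+ length rest    ≤⟨ ℕ.+-mono-≤ at-most-one rest≤B ⟩
  suc B                                              ∎
  where
  open ℕ.≤-Reasoning
  rest = filter (∁? (ℕ._≟ suc B)) ks
  at-most-one : length (filter (ℕ._≟ suc B) ks) ℕ.≤ 1
  at-most-one = unique-constant⇒length≤1 _ (Uniq.filter⁺ (ℕ._≟ suc B) uniq) (All.all-filter (ℕ._≟ suc B) ks)
  rest≤B : length rest ℕ.≤ B
  rest≤B = pigeonhole B rest (Uniq.filter⁺ _ uniq)
    (All.zipWith (λ { ((1≤k , k≤1+B) , k≢1+B) → 1≤k , ℕ.≤-pred (ℕ.≤∧≢⇒< k≤1+B k≢1+B) })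
      (All.filter⁺ _ bounded , All.all-filter _ ks))

pigeonhole-scaled : ∀ {u x} ks → 0ℚ < u → 0ℚ ≤ x → Unique ks →
  All (λ k → 1 ℕ.≤ k × toℚ k * u < x) ks → toℚ (length ks) * u ≤ x
pigeonhole-scaled {u} {x} ks 0<u 0≤x uniq bounded = begin
  toℚ (length ks) * u  ≤⟨ *-monoʳ-≤ u (<⇒≤ 0<u) (toℚ-mono-≤ length≤max) ⟩
  toℚ (max 0 ks) * u   ≤⟨ argmax-all id {P = λ k → toℚ k * u ≤ x}
                            (≤-trans (≤-reflexive (*-zeroˡ u)) 0≤x)
                            (All.map (λ (_ , ku<x) → <⇒≤ ku<x) bounded) ⟩
  x                    ∎
  where
  open ≤-Reasoning
  length≤max : length ks ℕ.≤ max 0 ks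
  length≤max = pigeonhole (max 0 ks) ks uniq
    (All.zipWith (λ ((1≤k , _) , k≤max) → 1≤k , k≤max) (bounded , xs≤max 0 ks))

module _ {d : ℕ} where

  quotients : ∀ {ns} → All (d ∣_) ns → List ℕ
  quotients []                = []
  quotients (divides q _ ∷ ps) = q ∷ quotients ps

  map-*-quotients : ∀ {ns} (ps : All (d ∣_) ns) → map (ℕ._* d) (quotients ps) ≡ ns
  map-*-quotients []                  = refl
  map-*-quotients (divides q eq ∷ ps) = cong₂ _∷_ (sym eq) (map-*-quotients ps)

length-multiples≤ : ∀ {d x} → 1 ℕ.≤ d → 0ℚ ≤ x → ∀ {ns} → Unique ns →
  All (λ n → 1 ℕ.≤ n × toℚ n < x) ns → All (d ∣_) ns → toℚ (length ns) ≤ x * recip d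
length-multiples≤ {d} {x} 1≤d 0≤x uniq bounded d∣ns =
  subst (λ ns → Unique ns → All (λ n → 1 ℕ.≤ n × toℚ n < x) ns → toℚ (length ns) ≤ x * recip d)
    (map-*-quotients d∣ns) (bound (quotients d∣ns)) uniq bounded
  where
  quotient-below : ∀ {k} → 1 ℕ.≤ k ℕ.* d × toℚ (k ℕ.* d) < x → 1 ℕ.≤ k × toℚ k * toℚ d < x
  quotient-below {zero}  (() , _)
  quotient-below {suc k} (_ , kd<x) = s≤s z≤n , subst (_< x) (toℚ-* (suc k) d) kd<x
  bound : ∀ ks → Unique (map (ℕ._* d) ks) → All (λ n → 1 ℕ.≤ n × toℚ n < x) (map (ℕ._* d) ks) →
          toℚ (length (map (ℕ._* d) ks)) ≤ x * recip d
  bound ks uniq bounded rewrite length-map (ℕ._* d) ks = ≤-*recip 1≤d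
    (pigeonhole-scaled ks (toℚ-pos 1≤d) 0≤x (Uniq.map⁻ uniq) (All.map quotient-below (All.map⁻ bounded)))

length≤*sumRecip : ∀ {x} → 0ℚ ≤ x → ∀ ds {ns} → All (1 ℕ.≤_) ds → Unique ns →
  All (λ n → 1 ℕ.≤ n × toℚ n < x) ns → All (λ n → ∃ λ d → d ∈ ds × d ∣ n) ns →
  toℚ (length ns) ≤ x * sumRecip ds
length≤*sumRecip {x} 0≤x []       _ _ _ []                  = ≤-reflexive (sym (*-zeroʳ x))
length≤*sumRecip     0≤x []       _ _ _ ((_ , () , _) ∷ _)
length≤*sumRecip {x} 0≤x (d ∷ ds) {ns} (1≤d ∷ 1≤ds) uniq bounded covered = begin
  toℚ (length ns)                        ≡⟨ cong toℚ (length-filter-split (d ∣?_) ns) ⟨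
  toℚ (length ns₁ ℕ.+ length ns₀)        ≡⟨ toℚ-+ (length ns₁) (length ns₀) ⟩
  toℚ (length ns₁) + toℚ (length ns₀)    ≤⟨ +-mono-≤ multiples rest ⟩
  x * recip d + x * sumRecip ds          ≡⟨ *-distribˡ-+ x _ _ ⟨
  x * sumRecip (d ∷ ds)                  ∎
  where
  open ≤-Reasoning
  ns₁ = filter (d ∣?_) ns
  ns₀ = filter (∁? (d ∣?_)) ns
  multiples : toℚ (length ns₁) ≤ x * recip d
  multiples = length-multiples≤ 1≤d 0≤x (Uniq.filter⁺ _ uniq) (All.filter⁺ _ bounded) (All.all-filter _ ns)
  covered₀ : All (λ n → ∃ λ d′ → d′ ∈ ds × d′ ∣ n) ns₀
  covered₀ = All.zipWith
    (λ { ((_ , here refl , d∣n) , d∤n) → ⊥-elim (d∤n d∣n)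
       ; ((d′ , there d′∈ds , d′∣n) , _) → d′ , d′∈ds , d′∣n })
    (All.filter⁺ _ covered , All.all-filter _ ns)
  rest : toℚ (length ns₀) ≤ x * sumRecip ds
  rest = length≤*sumRecip 0≤x ds 1≤ds (Uniq.filter⁺ _ uniq) (All.filter⁺ _ bounded) covered₀

module _ {Q : ℕ → Set} where

  witnesses : ∀ {ns} → All (λ n → ∃ λ d → d ∣ n × Q d) ns → List ℕ
  witnesses []             = []
  witnesses ((d , _) ∷ ws) = d ∷ witnesses ws

  witnesses-satisfy : ∀ {ns} (ws : All (λ n → ∃ λ d → d ∣ n × Q d) ns) → All Q (witnesses ws)
  witnesses-satisfy []                    = []
  witnesses-satisfy ((_ , _ , qd) ∷ ws) = qd ∷ witnesses-satisfy ws

  witnesses-cover : ∀ {ns} (ws : All (λ n → ∃ λ d → d ∣ n × Q d) ns) →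
    All (λ n → ∃ λ d → d ∈ witnesses ws × d ∣ n) ns
  witnesses-cover []                    = []
  witnesses-cover ((d , d∣n , _) ∷ ws) =
    (d , here refl , d∣n) ∷ All.map (λ (d′ , d′∈ , d′∣n) → d′ , there d′∈ , d′∣n) (witnesses-cover ws)

Friable : ℕ → ℕ → Set
Friable N m = ∀ p → Prime p → p ∣ m → p ℕ.≤ N

prime⇒≥2 : ∀ {p} → Prime p → 2 ℕ.≤ p
prime⇒≥2 {p} prime-p = ℕ.nonTrivial⇒n>1 p {{prime⇒nonTrivial prime-p}}

friable-mono : ∀ {N M m} → N ℕ.≤ M → Friable N m → Friable M m
friable-mono N≤M friable p prime-p p∣m = ℕ.≤-trans (friable p prime-p p∣m) N≤M

friable-∣ : ∀ {N d m} → d ∣ m → Friable N m → Friable N d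
friable-∣ d∣m friable p prime-p p∣d = friable p prime-p (∣-trans p∣d d∣m)

friable-pred : ∀ {N m} → Friable (suc N) m → ¬ (suc N ∣ m) → Friable N m
friable-pred friable N+1∤m p prime-p p∣m with ℕ.m≤n⇒m<n∨m≡n (friable p prime-p p∣m)
... | inj₁ p<N+1 = ℕ.≤-pred p<N+1
... | inj₂ refl  = ⊥-elim (N+1∤m p∣m)

friable₁⇒≡1 : ∀ {m} → 1 ℕ.≤ m → Friable 1 m → m ≡ 1
friable₁⇒≡1 {m} 1≤m friable with factorise m {{ℕ.>-nonZero 1≤m}}
... | record { factors = [] ; isFactorisation = m≡1 } = m≡1
... | record { factors = p ∷ ps ; isFactorisation = m≡Π ; factorsPrime = prime-p ∷ _ } =
  ⊥-elim (ℕ.<⇒≱ (prime⇒≥2 prime-p)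
    (friable p prime-p (subst (p ∣_) (sym m≡Π) (∈⇒∣product {ns = p ∷ ps} (here refl)))))

-- Rankin's trick

-- z ≤ t · m^{3/4}, raised to the fourth power to avoid roots.
Below¾ : ℚ → ℚ → ℕ → Set
Below¾ z t m = z ^ 4 ≤ t ^ 4 * toℚ m ^ 3

below¾-quotient : ∀ {z t} c k p → 0ℚ ≤ t → 1ℚ ≤ c ^ 4 * toℚ p →
  Below¾ z t (k ℕ.* p) → Below¾ z (t * (c * toℚ p)) k
below¾-quotient {z} {t} c k p 0≤t 1≤c⁴p below = begin
  z ^ 4                               ≤⟨ below ⟩
  t ^ 4 * toℚ (k ℕ.* p) ^ 3           ≡⟨ cong (λ w → t ^ 4 * w ^ 3) (toℚ-* k p) ⟩
  t ^ 4 * (K * P) ^ 3                 ≡⟨ *-identityʳ _ ⟨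
  t ^ 4 * (K * P) ^ 3 * 1ℚ            ≤⟨ *-monoˡ-≤ _ t⁴[KP]³-nonNeg 1≤c⁴p ⟩
  t ^ 4 * (K * P) ^ 3 * (c ^ 4 * P)   ≡⟨ solve 4 (λ t K P c → t :^ 4 :* (K :* P) :^ 3 :* (c :^ 4 :* P)
                                                 := (t :* (c :* P)) :^ 4 :* K :^ 3) refl t K P c ⟩
  (t * (c * P)) ^ 4 * K ^ 3           ∎
  where
  open ≤-Reasoning
  open ℚ-Solver.+-*-Solver
  K = toℚ k
  P = toℚ p
  t⁴[KP]³-nonNeg : 0ℚ ≤ t ^ 4 * (K * P) ^ 3
  t⁴[KP]³-nonNeg = *-nonNeg (^-nonNeg 4 0≤t) (^-nonNeg 3 (*-nonNeg (toℚ-nonNeg k) (toℚ-nonNeg p)))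

module Rankin (c f : ℕ → ℚ)
              (c-pos : ∀ p → 0ℚ < c p)
              (c⁴p≥1 : ∀ p → 2 ℕ.≤ p → 1ℚ ≤ c p ^ 4 * toℚ p)
              (f-nonNeg : ∀ p → 0ℚ ≤ f p)
              (f-geometric : ∀ p → 1ℚ + c p * f p ≡ f p)
              where

  -- The product runs over all integers 2 ≤ p ≤ N, prime or not: the induction below removes
  -- divisibility by each p in turn, and for composite p the factor is merely wasted.
  eulerProduct : ℕ → ℚ
  eulerProduct zero          = 1ℚ
  eulerProduct (suc zero)    = 1ℚ
  eulerProduct (suc (suc n)) = eulerProduct (suc n) * f (suc (suc n))

  eulerProduct-nonNeg : ∀ N → 0ℚ ≤ eulerProduct N
  eulerProduct-nonNeg zero          = ≤ᵇ⇒≤ _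
  eulerProduct-nonNeg (suc zero)    = ≤ᵇ⇒≤ _
  eulerProduct-nonNeg (suc (suc n)) = *-nonNeg (eulerProduct-nonNeg (suc n)) (f-nonNeg (suc (suc n)))

  RankinBound : ℕ → Set
  RankinBound N = ∀ {z t} ms → 0ℚ ≤ z → 0ℚ < t → Unique ms →
    All (λ m → 1 ℕ.≤ m × Friable N m × Below¾ z t m) ms → z * sumRecip ms ≤ t * eulerProduct N

  empty-bound : ∀ N {z t} → 0ℚ < t → z * sumRecip [] ≤ t * eulerProduct N
  empty-bound N {z} 0<t =
    ≤-trans (≤-reflexive (*-zeroʳ z)) (*-nonNeg (<⇒≤ 0<t) (eulerProduct-nonNeg N))

  rankin-base : ∀ N → N ℕ.≤ 1 → RankinBound N
  rankin-base N N≤1 {z} []        _   0<t _ _ = empty-bound N {z} 0<t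
  rankin-base N N≤1 (m ∷ m′ ∷ _) _   _   ((m≢m′ ∷ _) ∷ _) ((1≤m , fm , _) ∷ (1≤m′ , fm′ , _) ∷ _) =
    ⊥-elim (m≢m′ (trans (is-one 1≤m fm) (sym (is-one 1≤m′ fm′))))
    where
    is-one : ∀ {m} → 1 ℕ.≤ m → Friable N m → m ≡ 1
    is-one 1≤m fm = friable₁⇒≡1 1≤m (friable-mono N≤1 fm)
  rankin-base N N≤1 {z} {t} (m ∷ []) _ 0<t _ ((1≤m , fm , below) ∷ [])
    with refl ← friable₁⇒≡1 1≤m (friable-mono N≤1 fm) = begin
    z * (1ℚ + 0ℚ)       ≡⟨ cong (z *_) (+-identityʳ 1ℚ) ⟩
    z * 1ℚ              ≡⟨ *-identityʳ z ⟩
    z                   ≤⟨ ^-cancel-≤ 3 (<⇒≤ 0<t) (≤-trans below (≤-reflexive (*-identityʳ (t ^ 4)))) ⟩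
    t                   ≡⟨ *-identityʳ t ⟨
    t * 1ℚ              ≡⟨ cong (t *_) (eulerProduct≤1 N N≤1) ⟨
    t * eulerProduct N  ∎
    where
    open ≤-Reasoning
    eulerProduct≤1 : ∀ N → N ℕ.≤ 1 → eulerProduct N ≡ 1ℚ
    eulerProduct≤1 zero          _ = refl
    eulerProduct≤1 (suc zero)    _ = refl
    eulerProduct≤1 (suc (suc _)) (s≤s ())

  module _ (n : ℕ) (ih : RankinBound (suc n)) where
    private
      p : ℕ
      p = suc (suc n)
      P : ℚ
      P = toℚ p
      E : ℚ
      E = eulerProduct (suc n)

    BoundedHyp : ℕ → ℚ → ℚ → ℕ → Set
    BoundedHyp B z t m = m ℕ.≤ B × 1 ℕ.≤ m × Friable p m × Below¾ z t m

    quotient-hyp : ∀ {B z t k} → 0ℚ ≤ t → BoundedHyp (suc B) z t (k ℕ.* p) →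
                   BoundedHyp B z (t * (c p * P)) k
    quotient-hyp {k = zero}  _   (_ , () , _)
    quotient-hyp {z = z} {t} {suc k} 0≤t (kp≤1+B , _ , fkp , below) =
      ℕ.≤-pred (ℕ.<-≤-trans (ℕ.m<m*n (suc k) p (s≤s (s≤s z≤n))) kp≤1+B) ,
      s≤s z≤n ,
      friable-∣ (m∣m*n p) fkp ,
      below¾-quotient {z} {t} (c p) (suc k) p 0≤t (c⁴p≥1 p (s≤s (s≤s z≤n))) below

    -- Multiples m = k p contribute (1/p) Σ 1/k with t rescaled by c p · p (≥ p^{3/4}) and a
    -- smaller bound B; the remaining m are (p-1)-friable.  Then 1 + c p · f p = f p closes the sum.
    rankin-bounded : ∀ B {z t} ms → 0ℚ ≤ z → 0ℚ < t → Unique ms →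
      All (BoundedHyp B z t) ms → z * sumRecip ms ≤ t * (E * f p)

    multiples-bound : ∀ B {z t ms} → 0ℚ ≤ z → 0ℚ < t → Unique ms →
      All (BoundedHyp (suc B) z t) ms → All (p ∣_) ms → z * sumRecip ms ≤ t * c p * (E * f p)
    multiples-bound B {z} {t} 0≤z 0<t uniq hyps p∣ms =
      subst (λ ms → Unique ms → All (BoundedHyp (suc B) z t) ms → z * sumRecip ms ≤ t * c p * (E * f p))
        (map-*-quotients p∣ms) (bound (quotients p∣ms)) uniq hyps
      where
      bound : ∀ ks → Unique (map (ℕ._* p) ks) → All (BoundedHyp (suc B) z t) (map (ℕ._* p) ks) →
              z * sumRecip (map (ℕ._* p) ks) ≤ t * c p * (E * f p)
      bound ks uniq hyps = *-cancelʳ-≤ P (toℚ-pos {p} (s≤s z≤n)) (begin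
        z * sumRecip (map (ℕ._* p) ks) * P    ≡⟨ *-assoc z _ P ⟩
        z * (sumRecip (map (ℕ._* p) ks) * P)  ≡⟨ cong (z *_) (sumRecip-map-* (suc n) ks) ⟩
        z * sumRecip ks                       ≤⟨ rankin-bounded B ks 0≤z 0<t′ (Uniq.map⁻ uniq)
                                                   (All.map (quotient-hyp {z = z} {t} (<⇒≤ 0<t)) (All.map⁻ hyps)) ⟩
        t * (c p * P) * (E * f p)             ≡⟨ solve 5 (λ t c P E f → t :* (c :* P) :* (E :* f)
                                                    := t :* c :* (E :* f) :* P) refl t (c p) P E (f p) ⟩
        t * c p * (E * f p) * P               ∎)
        where
        open ≤-Reasoning
        open ℚ-Solver.+-*-Solver
        0<t′ : 0ℚ < t * (c p * P)
        0<t′ = *-pos 0<t (*-pos (c-pos p) (toℚ-pos {p} (s≤s z≤n)))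

    rankin-bounded zero    {z} []      _ 0<t _ [] = empty-bound p {z} 0<t
    rankin-bounded zero    (_ ∷ _) _ _ _ ((m≤0 , 1≤m , _) ∷ _) = ⊥-elim (ℕ.<⇒≱ 1≤m m≤0)
    rankin-bounded (suc B) {z} {t} ms 0≤z 0<t uniq hyps = begin
      z * sumRecip ms                          ≡⟨ cong (z *_) (sumRecip-filter-split (p ∣?_) ms) ⟨
      z * (sumRecip ms₁ + sumRecip ms₀)        ≡⟨ *-distribˡ-+ z _ _ ⟩
      z * sumRecip ms₁ + z * sumRecip ms₀      ≤⟨ +-mono-≤ divisible indivisible ⟩
      t * c p * (E * f p) + t * E              ≡⟨ solve 4 (λ t c E f → t :* c :* (E :* f) :+ t :* E
                                                     := t :* (E :* (con 1ℚ :+ c :* f))) refl t (c p) E (f p) ⟩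
      t * (E * (1ℚ + c p * f p))               ≡⟨ cong (λ w → t * (E * w)) (f-geometric p) ⟩
      t * (E * f p)                            ∎
      where
      open ≤-Reasoning
      open ℚ-Solver.+-*-Solver
      ms₁ = filter (p ∣?_) ms
      ms₀ = filter (∁? (p ∣?_)) ms
      divisible : z * sumRecip ms₁ ≤ t * c p * (E * f p)
      divisible = multiples-bound B 0≤z 0<t (Uniq.filter⁺ _ uniq) (All.filter⁺ _ hyps) (All.all-filter _ ms)
      indivisible : z * sumRecip ms₀ ≤ t * E
      indivisible = ih ms₀ 0≤z 0<t (Uniq.filter⁺ _ uniq)
        (All.zipWith (λ ((_ , 1≤m , fm , below) , p∤m) → 1≤m , friable-pred fm p∤m , below)
          (All.filter⁺ _ hyps , All.all-filter _ ms))

  rankin : ∀ N → RankinBound N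
  rankin zero                = rankin-base 0 z≤n
  rankin (suc zero)          = rankin-base 1 ℕ.≤-refl
  rankin (suc (suc n)) ms 0≤z 0<t uniq hyps =
    rankin-bounded n (rankin (suc n)) (max 0 ms) ms 0≤z 0<t uniq (All.zipWith id (xs≤max 0 ms , hyps))

-- The exponential series

expTerm-*-! : ∀ p k → expTerm p k * toℚ (k ℕ.!) ≡ toℚ (p ℕ.^ k)
expTerm-*-! p zero    = refl
expTerm-*-! p (suc k) = begin
  expTerm p k * d * toℚ (suc k ℕ.* k ℕ.!)          ≡⟨ cong (expTerm p k * d *_) (toℚ-* (suc k) (k ℕ.!)) ⟩
  expTerm p k * d * (toℚ (suc k) * toℚ (k ℕ.!))    ≡⟨ solve 4 (λ e d s f → e :* d :* (s :* f) := d :* s :* (e :* f))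
                                                         refl (expTerm p k) d (toℚ (suc k)) (toℚ (k ℕ.!)) ⟩
  d * toℚ (suc k) * (expTerm p k * toℚ (k ℕ.!))    ≡⟨ cong₂ _*_ (/-*-cancel p k) (expTerm-*-! p k) ⟩
  toℚ p * toℚ (p ℕ.^ k)                            ≡⟨ toℚ-* p (p ℕ.^ k) ⟨
  toℚ (p ℕ.^ suc k)                                ∎
  where
  open ≡-Reasoning
  open ℚ-Solver.+-*-Solver
  d = + p / suc k

expTerm-nonNeg : ∀ p k → 0ℚ ≤ expTerm p k
expTerm-nonNeg p zero    = ≤ᵇ⇒≤ _
expTerm-nonNeg p (suc k) = *-nonNeg (expTerm-nonNeg p k) (nonNegative⁻¹ _ {{normalize-nonNeg p (suc k)}})

expPartial-nonNeg : ∀ p k → 0ℚ ≤ expPartial p k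
expPartial-nonNeg p zero    = ≤ᵇ⇒≤ _
expPartial-nonNeg p (suc k) = +-mono-≤ (expPartial-nonNeg p k) (expTerm-nonNeg p (suc k))

expTerm≤expPartial : ∀ p k → expTerm p k ≤ expPartial p k
expTerm≤expPartial p zero    = ≤-refl
expTerm≤expPartial p (suc k) =
  ≤-trans (≤-reflexive (sym (+-identityˡ _))) (+-monoˡ-≤ (expTerm p (suc k)) (expPartial-nonNeg p k))

bernoulli : ∀ a m → a ℕ.^ suc m ℕ.+ suc m ℕ.* a ℕ.^ m ℕ.≤ suc a ℕ.^ suc m
bernoulli a zero    = ℕ.≤-reflexive (solve 1 (λ a → a :* con 1 :+ con 1 :* con 1 := (con 1 :+ a) :* con 1) refl a)
  where open ℕ-Solver.+-*-Solver
bernoulli a (suc m) = begin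
  a ℕ.^ suc (suc m) ℕ.+ suc (suc m) ℕ.* a ℕ.^ suc m
    ≤⟨ ℕ.m≤m+n _ (suc m ℕ.* a ℕ.^ m) ⟩
  a ℕ.^ suc (suc m) ℕ.+ suc (suc m) ℕ.* a ℕ.^ suc m ℕ.+ suc m ℕ.* a ℕ.^ m
    ≡⟨ solve 3 (λ a m w → a :* (a :* w) :+ (con 2 :+ m) :* (a :* w) :+ (con 1 :+ m) :* w
                   := (con 1 :+ a) :* (a :* w :+ (con 1 :+ m) :* w)) refl a m (a ℕ.^ m) ⟩
  suc a ℕ.* (a ℕ.^ suc m ℕ.+ suc m ℕ.* a ℕ.^ m)
    ≤⟨ ℕ.*-monoʳ-≤ (suc a) (bernoulli a m) ⟩
  suc a ℕ.^ suc (suc m) ∎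
  where
  open ℕ.≤-Reasoning
  open ℕ-Solver.+-*-Solver

2^n*[1+n]!≤[1+n]^[1+n] : ∀ n → 2 ℕ.^ n ℕ.* suc n ℕ.! ℕ.≤ suc n ℕ.^ suc n
2^n*[1+n]!≤[1+n]^[1+n] zero    = ℕ.≤-refl
2^n*[1+n]!≤[1+n]^[1+n] (suc n) = begin
  2 ℕ.^ suc n ℕ.* suc (suc n) ℕ.!                ≡⟨ solve 3 (λ t s f → con 2 :* t :* (s :* f) := s :* (con 2 :* (t :* f)))
                                                        refl (2 ℕ.^ n) (suc (suc n)) (suc n ℕ.!) ⟩
  suc (suc n) ℕ.* (2 ℕ.* (2 ℕ.^ n ℕ.* suc n ℕ.!)) ≤⟨ ℕ.*-monoʳ-≤ (suc (suc n))
                                                       (ℕ.*-monoʳ-≤ 2 (2^n*[1+n]!≤[1+n]^[1+n] n)) ⟩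
  suc (suc n) ℕ.* (2 ℕ.* suc n ℕ.^ suc n)        ≤⟨ ℕ.*-monoʳ-≤ (suc (suc n)) twice≤ ⟩
  suc (suc n) ℕ.^ suc (suc n)                    ∎
  where
  open ℕ.≤-Reasoning
  open ℕ-Solver.+-*-Solver
  twice≤ : 2 ℕ.* suc n ℕ.^ suc n ℕ.≤ suc (suc n) ℕ.^ suc n
  twice≤ = ℕ.≤-trans (ℕ.≤-reflexive (cong (suc n ℕ.^ suc n ℕ.+_) (ℕ.+-identityʳ _))) (bernoulli (suc n) n)

expLe⇒2^n≤x² : ∀ n x → ExpLe (suc n) x → toℚ (2 ℕ.^ n) ≤ x * x
expLe⇒2^n≤x² n x e^p≤x² = begin
  toℚ (2 ℕ.^ n)        ≤⟨ *-cancelʳ-≤ (toℚ (p ℕ.!)) (toℚ-pos (ℕ.1≤n! p)) 2^n*p!≤p^p ⟩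
  expTerm p p          ≤⟨ expTerm≤expPartial p p ⟩
  expPartial p p       ≤⟨ e^p≤x² p ⟩
  x * x                ∎
  where
  open ≤-Reasoning
  p = suc n
  2^n*p!≤p^p : toℚ (2 ℕ.^ n) * toℚ (p ℕ.!) ≤ expTerm p p * toℚ (p ℕ.!)
  2^n*p!≤p^p = begin
    toℚ (2 ℕ.^ n) * toℚ (p ℕ.!)   ≡⟨ toℚ-* (2 ℕ.^ n) (p ℕ.!) ⟨
    toℚ (2 ℕ.^ n ℕ.* p ℕ.!)       ≤⟨ toℚ-mono-≤ (2^n*[1+n]!≤[1+n]^[1+n] n) ⟩
    toℚ (p ℕ.^ p)                 ≡⟨ expTerm-*-! p p ⟨
    expTerm p p * toℚ (p ℕ.!)     ∎

friable2logx⇒friable : ∀ {x k m} → x * x < toℚ (2 ℕ.^ suc k) → Friable2logx x m → Friable (suc k) m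
friable2logx⇒friable _ _ zero prime-0 _ = ⊥-elim (ℕ.<⇒≱ (prime⇒≥2 prime-0) z≤n)
friable2logx⇒friable {x} {k} x²<2^[1+k] friable (suc q) prime-q q∣m = s≤s (ℕ.≮⇒≥ λ k<q →
  <-irrefl refl (<-≤-trans x²<2^[1+k]
    (≤-trans (toℚ-mono-≤ (ℕ.^-monoʳ-≤ 2 k<q)) (expLe⇒2^n≤x² q x (friable (suc q) prime-q q∣m)))))

-- Opaque, so that the astronomically large constants built from it are never normalised.
opaque
  largePrimeThreshold : ℕ
  largePrimeThreshold = 100000000

-- c p ≥ p^{-1/4}, and f p = 1 / (1 - c p) = Σ_j (c p)^j.
rankinC : ℕ → ℚ
rankinC p with p ℕ.<? largePrimeThreshold
... | yes _ = + 7 / 8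
... | no  _ = + 1 / 100

rankinF : ℕ → ℚ
rankinF p with p ℕ.<? largePrimeThreshold
... | yes _ = + 8 / 1
... | no  _ = + 100 / 99

rankinC-pos : ∀ p → 0ℚ < rankinC p
rankinC-pos p with p ℕ.<? largePrimeThreshold
... | yes _ = *<* (ℤ.+<+ (s≤s z≤n))
... | no  _ = *<* (ℤ.+<+ (s≤s z≤n))

opaque
  unfolding largePrimeThreshold

  threshold⁻¹/⁴ : 1ℚ ≤ (+ 1 / 100) ^ 4 * toℚ largePrimeThreshold
  threshold⁻¹/⁴ = ≤ᵇ⇒≤ _

rankinC⁴p≥1 : ∀ p → 2 ℕ.≤ p → 1ℚ ≤ rankinC p ^ 4 * toℚ p
rankinC⁴p≥1 p 2≤p with p ℕ.<? largePrimeThreshold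
... | yes _ = ≤-trans (≤ᵇ⇒≤ {1ℚ} {(+ 7 / 8) ^ 4 * toℚ 2} _)
                (*-monoˡ-≤ ((+ 7 / 8) ^ 4) (≤ᵇ⇒≤ _) (toℚ-mono-≤ 2≤p))
... | no  p≮T = ≤-trans threshold⁻¹/⁴
                  (*-monoˡ-≤ ((+ 1 / 100) ^ 4) (≤ᵇ⇒≤ _) (toℚ-mono-≤ (ℕ.≮⇒≥ p≮T)))

rankinF-nonNeg : ∀ p → 0ℚ ≤ rankinF p
rankinF-nonNeg p with p ℕ.<? largePrimeThreshold
... | yes _ = ≤ᵇ⇒≤ _
... | no  _ = ≤ᵇ⇒≤ _

rankinF-geometric : ∀ p → 1ℚ + rankinC p * rankinF p ≡ rankinF p
rankinF-geometric p with p ℕ.<? largePrimeThreshold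
... | yes _ = refl
... | no  _ = refl

open Rankin rankinC rankinF rankinC-pos rankinC⁴p≥1 rankinF-nonNeg rankinF-geometric
  using (eulerProduct; eulerProduct-nonNeg; rankin)

opaque
  smallPrimeFactor : ℕ
  smallPrimeFactor = 8 ℕ.^ 48

  smallPrimeFactor-pos : 1 ℕ.≤ smallPrimeFactor
  smallPrimeFactor-pos = ℕ.m^n>0 8 48

  8⁴⁸≡smallPrimeFactor : toℚ 8 ^ 48 ≡ toℚ smallPrimeFactor
  8⁴⁸≡smallPrimeFactor = sym (toℚ-^ 8 48)

instance
  smallPrimeFactor-nonZero : ℕ.NonZero smallPrimeFactor
  smallPrimeFactor-nonZero = ℕ.>-nonZero smallPrimeFactor-pos

factorBound : ℕ → ℕ
factorBound p with p ℕ.<? largePrimeThreshold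
... | yes _ = smallPrimeFactor
... | no  _ = 1

rankinF⁴⁸≤ : ∀ p → rankinF p ^ 48 ≤ toℚ (2 ℕ.* factorBound p)
rankinF⁴⁸≤ p with p ℕ.<? largePrimeThreshold
... | yes _ = ≤-trans (≤-reflexive 8⁴⁸≡smallPrimeFactor) (toℚ-mono-≤ (ℕ.m≤n*m smallPrimeFactor 2))
... | no  _ = ≤ᵇ⇒≤ _

factorBound-accumulate : ∀ n → smallPrimeFactor ℕ.^ (n ℕ.⊓ largePrimeThreshold) ℕ.* factorBound (suc (suc n))
                         ℕ.≤ smallPrimeFactor ℕ.^ (suc n ℕ.⊓ largePrimeThreshold)
factorBound-accumulate n with suc (suc n) ℕ.<? largePrimeThreshold
... | yes p<T with 1+n≤T ← ℕ.<⇒≤ (ℕ.<-trans (ℕ.n<1+n (suc n)) p<T)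
  rewrite ℕ.m≤n⇒m⊓n≡m (ℕ.≤-trans (ℕ.n≤1+n n) 1+n≤T) | ℕ.m≤n⇒m⊓n≡m 1+n≤T =
  ℕ.≤-reflexive (ℕ.*-comm (smallPrimeFactor ℕ.^ n) smallPrimeFactor)
... | no  _ = begin
  smallPrimeFactor ℕ.^ (n ℕ.⊓ largePrimeThreshold) ℕ.* 1 ≡⟨ ℕ.*-identityʳ _ ⟩
  smallPrimeFactor ℕ.^ (n ℕ.⊓ largePrimeThreshold)       ≤⟨ ℕ.^-monoʳ-≤ smallPrimeFactor
                                                               (ℕ.⊓-monoˡ-≤ _ (ℕ.n≤1+n n)) ⟩
  smallPrimeFactor ℕ.^ (suc n ℕ.⊓ largePrimeThreshold)   ∎
  where open ℕ.≤-Reasoning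

eulerProduct⁴⁸≤ : ∀ n →
  eulerProduct (suc n) ^ 48 ≤ toℚ (2 ℕ.^ n ℕ.* smallPrimeFactor ℕ.^ (n ℕ.⊓ largePrimeThreshold))
eulerProduct⁴⁸≤ zero    = ≤ᵇ⇒≤ _
eulerProduct⁴⁸≤ (suc n) = begin
  (E * rankinF p) ^ 48                    ≡⟨ ^-distrib-* E (rankinF p) 48 ⟩
  E ^ 48 * rankinF p ^ 48                 ≤⟨ *-mono-≤ (^-nonNeg 48 (eulerProduct-nonNeg (suc n)))
                                               (^-nonNeg 48 (rankinF-nonNeg p)) (eulerProduct⁴⁸≤ n) (rankinF⁴⁸≤ p) ⟩
  toℚ (2 ℕ.^ n ℕ.* a) * toℚ (2 ℕ.* factorBound p) ≡⟨ toℚ-* (2 ℕ.^ n ℕ.* a) _ ⟨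
  toℚ (2 ℕ.^ n ℕ.* a ℕ.* (2 ℕ.* factorBound p))   ≤⟨ toℚ-mono-≤ ℕ-bound ⟩
  toℚ (2 ℕ.^ suc n ℕ.* smallPrimeFactor ℕ.^ (suc n ℕ.⊓ largePrimeThreshold)) ∎
  where
  open ≤-Reasoning
  p = suc (suc n)
  E = eulerProduct (suc n)
  a = smallPrimeFactor ℕ.^ (n ℕ.⊓ largePrimeThreshold)
  ℕ-bound : 2 ℕ.^ n ℕ.* a ℕ.* (2 ℕ.* factorBound p)
            ℕ.≤ 2 ℕ.^ suc n ℕ.* smallPrimeFactor ℕ.^ (suc n ℕ.⊓ largePrimeThreshold)
  ℕ-bound = ℕ.≤-trans
    (ℕ.≤-reflexive (solve 3 (λ t a h → t :* a :* (con 2 :* h) := con 2 :* t :* (a :* h))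
                      refl (2 ℕ.^ n) a (factorBound p)))
    (ℕ.*-monoʳ-≤ (2 ℕ.^ suc n) (factorBound-accumulate n))
    where open ℕ-Solver.+-*-Solver

smallPrimesBound : ℕ
smallPrimesBound = smallPrimeFactor ℕ.^ largePrimeThreshold

eulerProduct⁴⁸≤x²K : ∀ {x k} → toℚ (2 ℕ.^ k) ≤ x * x →
  eulerProduct (suc k) ^ 48 ≤ x * x * toℚ smallPrimesBound
eulerProduct⁴⁸≤x²K {x} {k} 2^k≤x² = begin
  eulerProduct (suc k) ^ 48                             ≤⟨ eulerProduct⁴⁸≤ k ⟩
  toℚ (2 ℕ.^ k ℕ.* smallPrimeFactor ℕ.^ m)              ≡⟨ toℚ-* (2 ℕ.^ k) _ ⟩
  toℚ (2 ℕ.^ k) * toℚ (smallPrimeFactor ℕ.^ m)          ≤⟨ *-mono-≤ (toℚ-nonNeg (2 ℕ.^ k)) (toℚ-nonNeg (smallPrimeFactor ℕ.^ m))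
                                                             2^k≤x² (toℚ-mono-≤ m≤T) ⟩
  x * x * toℚ smallPrimesBound                          ∎
  where
  open ≤-Reasoning
  m = k ℕ.⊓ largePrimeThreshold
  m≤T : smallPrimeFactor ℕ.^ m ℕ.≤ smallPrimesBound
  m≤T = ℕ.^-monoʳ-≤ smallPrimeFactor {m} {largePrimeThreshold} (ℕ.m⊓n≤n k largePrimeThreshold)

bracket : ∀ (f : ℕ → ℚ) {q} k n → f k ≤ q → q < f (k ℕ.+ n) →
          ∃ λ r → k ℕ.≤ r × f r ≤ q × q < f (suc r)
bracket f {q} k zero    fk≤q q<fk =
  ⊥-elim (<-irrefl refl (<-≤-trans (subst (λ j → q < f j) (ℕ.+-identityʳ k) q<fk) fk≤q))
bracket f {q} k (suc n) fk≤q q<f with f (suc k) ≤? q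
... | no  f[1+k]≰q = k , ℕ.≤-refl , fk≤q , ≰⇒> f[1+k]≰q
... | yes f[1+k]≤q =
  let r , 1+k≤r , fr≤q , q<f[1+r] = bracket f (suc k) n f[1+k]≤q (subst (λ j → q < f j) (ℕ.+-suc k n) q<f)
  in r , ℕ.<⇒≤ 1+k≤r , fr≤q , q<f[1+r]

log₂-bracket : ∀ {y} → 1ℚ ≤ y → ∃ λ k → toℚ (2 ℕ.^ k) ≤ y × y < toℚ (2 ℕ.^ suc k)
log₂-bracket {y} 1≤y =
  let k , _ , 2^k≤y , y<2^[1+k] = bracket (λ k → toℚ (2 ℕ.^ k)) 0 (suc a) 1≤y
        (≤-<-trans (≤-toℚ∣↥∣ y) (toℚ-mono-< (ℕ.<-trans (ℕ.n<1+n a) (n<2^n (suc a)))))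
  in k , 2^k≤y , y<2^[1+k]
  where a = ℤ.∣ ↥ y ∣

eighth-root-bracket : ∀ {y} → 1ℚ ≤ y → ∃ λ r → 1 ℕ.≤ r × toℚ r ^ 8 ≤ y × y < toℚ (suc r) ^ 8
eighth-root-bracket {y} 1≤y = bracket (λ r → toℚ r ^ 8) 1 a (≤-trans (≤ᵇ⇒≤ _) 1≤y) (begin-strict
  y                   ≤⟨ ≤-toℚ∣↥∣ y ⟩
  toℚ a               <⟨ toℚ-mono-< (ℕ.n<1+n a) ⟩
  toℚ (suc a)         ≤⟨ toℚ-mono-≤ (m≤m^[1+k] (suc a) 7 (s≤s z≤n)) ⟩
  toℚ (suc a ℕ.^ 8)   ≡⟨ toℚ-^ (suc a) 8 ⟩
  toℚ (suc a) ^ 8     ∎)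
  where
  open ≤-Reasoning
  a = ℤ.∣ ↥ y ∣

friableConstant : ℕ
friableConstant = 256 ℕ.^ 6 ℕ.* smallPrimesBound

256⁶K≤C⁴⁸ : toℚ 256 ^ 6 * toℚ smallPrimesBound ≤ toℚ friableConstant ^ 48
256⁶K≤C⁴⁸ = begin
  toℚ 256 ^ 6 * toℚ smallPrimesBound   ≡⟨ cong (_* toℚ smallPrimesBound) (toℚ-^ 256 6) ⟨
  toℚ (256 ℕ.^ 6) * toℚ smallPrimesBound ≡⟨ toℚ-* (256 ℕ.^ 6) smallPrimesBound ⟨
  toℚ friableConstant                  ≤⟨ toℚ-mono-≤ (m≤m^[1+k] friableConstant 47 1≤C) ⟩
  toℚ (friableConstant ℕ.^ 48)         ≡⟨ toℚ-^ friableConstant 48 ⟩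
  toℚ friableConstant ^ 48             ∎
  where
  open ≤-Reasoning
  1≤C : 1 ℕ.≤ friableConstant
  1≤C = ℕ.*-mono-≤ (ℕ.m^n>0 256 6) (ℕ.m^n>0 smallPrimeFactor largePrimeThreshold)

aboveSqrt⇒below¾ : ∀ {x r m} → 0ℚ ≤ x → toℚ r ^ 8 ≤ x ^ 3 → AboveSqrt x m → Below¾ (toℚ r) 1ℚ m
aboveSqrt⇒below¾ {x} {r} {m} 0≤x r⁸≤x³ x<m² =
  ≤-trans (^-cancel-≤ 1 (^-nonNeg 3 (toℚ-nonNeg m)) (begin
    (R ^ 4) ^ 2   ≡⟨ ^-assocʳ R 4 2 ⟩
    R ^ 8         ≤⟨ r⁸≤x³ ⟩
    x ^ 3         ≤⟨ ^-mono-≤ 3 0≤x (<⇒≤ x<m²) ⟩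
    (M * M) ^ 3   ≡⟨ solve 1 (λ M → (M :* M) :^ 3 := (M :^ 3) :^ 2) refl M ⟩
    (M ^ 3) ^ 2   ∎))
  (≤-reflexive (sym (*-identityˡ (M ^ 3))))
  where
  open ≤-Reasoning
  open ℚ-Solver.+-*-Solver
  R = toℚ r
  M = toℚ m

below-next-eighth-power : ∀ {y r} → 1 ℕ.≤ r → y < toℚ (suc r) ^ 8 → y ≤ toℚ 256 * toℚ r ^ 8
below-next-eighth-power {y} {r} 1≤r y<[1+r]⁸ = begin
  y                       ≤⟨ <⇒≤ y<[1+r]⁸ ⟩
  toℚ (suc r) ^ 8         ≤⟨ ^-mono-≤ 8 (toℚ-nonNeg (suc r)) (toℚ-mono-≤ 1+r≤2r) ⟩
  toℚ (2 ℕ.* r) ^ 8       ≡⟨ cong (_^ 8) (toℚ-* 2 r) ⟩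
  (toℚ 2 * toℚ r) ^ 8     ≡⟨ ^-distrib-* (toℚ 2) (toℚ r) 8 ⟩
  toℚ 2 ^ 8 * toℚ r ^ 8   ≡⟨ cong (_* toℚ r ^ 8) (toℚ-^ 2 8) ⟨
  toℚ 256 * toℚ r ^ 8     ∎
  where
  open ≤-Reasoning
  1+r≤2r : suc r ℕ.≤ 2 ℕ.* r
  1+r≤2r = ℕ.≤-trans (ℕ.+-monoˡ-≤ r 1≤r) (ℕ.≤-reflexive (cong (r ℕ.+_) (sym (ℕ.+-identityʳ r))))

rankin-exponents : ∀ {S x R E K} → 0ℚ ≤ S → 0ℚ < x → 0ℚ ≤ R → R * S ≤ E →
  x ^ 3 ≤ toℚ 256 * R ^ 8 → E ^ 48 ≤ x * x * K → S ^ 48 * x ^ 16 ≤ toℚ 256 ^ 6 * K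
rankin-exponents {S} {x} {R} {E} {K} 0≤S 0<x 0≤R RS≤E x³≤256R⁸ E⁴⁸≤x²K =
  *-cancelʳ-≤ (x * x) (*-pos 0<x 0<x) (begin
    S ^ 48 * x ^ 16 * (x * x)
      ≡⟨ solve 2 (λ S x → S :^ 48 :* x :^ 16 :* (x :* x) := S :^ 48 :* (x :^ 3) :^ 6) refl S x ⟩
    S ^ 48 * (x ^ 3) ^ 6
      ≤⟨ *-monoˡ-≤ (S ^ 48) (^-nonNeg 48 0≤S) (^-mono-≤ 6 (^-nonNeg 3 (<⇒≤ 0<x)) x³≤256R⁸) ⟩
    S ^ 48 * (toℚ 256 * R ^ 8) ^ 6
      ≡⟨ solve 3 (λ S c R → S :^ 48 :* (c :* R :^ 8) :^ 6 := c :^ 6 :* (R :* S) :^ 48) refl S (toℚ 256) R ⟩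
    toℚ 256 ^ 6 * (R * S) ^ 48
      ≤⟨ *-monoˡ-≤ (toℚ 256 ^ 6) 0≤256⁶ (^-mono-≤ 48 (*-nonNeg 0≤R 0≤S) RS≤E) ⟩
    toℚ 256 ^ 6 * E ^ 48
      ≤⟨ *-monoˡ-≤ (toℚ 256 ^ 6) 0≤256⁶ E⁴⁸≤x²K ⟩
    toℚ 256 ^ 6 * (x * x * K)
      ≡⟨ solve 3 (λ c x K → c :* (x :* x :* K) := c :* K :* (x :* x)) refl (toℚ 256 ^ 6) x K ⟩
    toℚ 256 ^ 6 * K * (x * x) ∎)
  where
  open ≤-Reasoning
  open ℚ-Solver.+-*-Solver
  0≤256⁶ : 0ℚ ≤ toℚ 256 ^ 6
  0≤256⁶ = ^-nonNeg 6 (toℚ-nonNeg 256)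

cube-root-bound : ∀ {S x C} → 0ℚ ≤ C → S ^ 48 * x ^ 16 ≤ C ^ 48 → cube S * x ≤ cube C
cube-root-bound {S} {x} {C} 0≤C S⁴⁸x¹⁶≤C⁴⁸ = ^-cancel-≤ 15 (*-nonNeg (*-nonNeg 0≤C 0≤C) 0≤C) (begin
  (S * S * S * x) ^ 16   ≡⟨ solve 2 (λ S x → (S :* S :* S :* x) :^ 16 := S :^ 48 :* x :^ 16) refl S x ⟩
  S ^ 48 * x ^ 16        ≤⟨ S⁴⁸x¹⁶≤C⁴⁸ ⟩
  C ^ 48                 ≡⟨ solve 1 (λ C → C :^ 48 := (C :* C :* C) :^ 16) refl C ⟩
  (C * C * C) ^ 16       ∎)
  where
  open ≤-Reasoning
  open ℚ-Solver.+-*-Solver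

friable-reciprocal-sum : ∀ x → 1ℚ ≤ x → ∀ ms → Unique ms →
  All (λ m → 1 ℕ.≤ m × AboveSqrt x m × Friable2logx x m) ms →
  cube (sumRecip ms) * x ≤ cube (toℚ friableConstant)
friable-reciprocal-sum x 1≤x ms uniq hyps =
  let k , 2^k≤x² , x²<2^[1+k]     = log₂-bracket {x * x} (*-mono-≤ 0≤1 0≤1 1≤x 1≤x)
      r , 1≤r , r⁸≤x³ , x³<[1+r]⁸ = eighth-root-bracket {x ^ 3} (^-mono-≤ 3 0≤1 1≤x)
      E = eulerProduct (suc k)
      rS≤E : toℚ r * sumRecip ms ≤ E
      rS≤E = ≤-trans
        (rankin (suc k) ms (toℚ-nonNeg r) 0ℚ<1ℚ uniq (All.map (λ {m} (1≤m , above , friable) →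
          1≤m , friable2logx⇒friable {x} {k} {m} x²<2^[1+k] friable ,
          aboveSqrt⇒below¾ {x} {r} {m} (<⇒≤ 0<x) r⁸≤x³ above) hyps))
        (≤-reflexive (*-identityˡ E))
  in cube-root-bound {sumRecip ms} {x} (toℚ-nonNeg friableConstant) (≤-trans
       (rankin-exponents {sumRecip ms} {x} {toℚ r} {E} {toℚ smallPrimesBound}
         (sumRecip-nonNeg ms) 0<x (toℚ-nonNeg r) rS≤E
         (below-next-eighth-power {x ^ 3} {r} 1≤r x³<[1+r]⁸) (eulerProduct⁴⁸≤x²K {x} {k} 2^k≤x²))
       256⁶K≤C⁴⁸)
  where
  0≤1 : 0ℚ ≤ 1ℚ
  0≤1 = <⇒≤ 0ℚ<1ℚ
  0<x : 0ℚ < x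
  0<x = <-≤-trans 0ℚ<1ℚ 1≤x

friable-divisor-count : ∀ x → 1ℚ ≤ x → ∀ ns → Unique ns →
  All (λ n → 1 ℕ.≤ n × toℚ n < x × ∃ λ d → d ∣ n × AboveSqrt x d × Friable2logx x d) ns →
  cube (toℚ (length ns)) ≤ cube (toℚ friableConstant) * (x * x)
friable-divisor-count x 1≤x ns uniq hyps = begin
  cube (toℚ (length ns))   ≤⟨ cube-mono-≤ (toℚ-nonNeg (length ns)) count ⟩
  cube (x * S)             ≡⟨ solve 2 (λ x S → (x :* S) :* (x :* S) :* (x :* S)
                                          := x :* x :* (S :* S :* S :* x)) refl x S ⟩
  x * x * (cube S * x)     ≤⟨ *-monoˡ-≤ (x * x) (*-nonNeg 0≤x 0≤x)
                                (friable-reciprocal-sum x 1≤x ds (Uniq.deduplicate-! _) divisors-hyps) ⟩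
  x * x * cube C           ≡⟨ *-comm (x * x) (cube C) ⟩
  cube C * (x * x)         ∎
  where
  open ≤-Reasoning
  open ℚ-Solver.+-*-Solver
  C = toℚ friableConstant
  0≤x : 0ℚ ≤ x
  0≤x = ≤-trans (≤ᵇ⇒≤ _) 1≤x
  ws : All (λ n → ∃ λ d → d ∣ n × (1 ℕ.≤ d × AboveSqrt x d × Friable2logx x d)) ns
  ws = All.map (λ (1≤n , _ , d , d∣n , above , friable) →
                  d , d∣n , divisor-pos d∣n 1≤n , above , friable) hyps
  ds = deduplicate ℕ._≟_ (witnesses ws)
  S = sumRecip ds
  divisors-hyps : All (λ d → 1 ℕ.≤ d × AboveSqrt x d × Friable2logx x d) ds
  divisors-hyps = All.deduplicate⁺ ℕ._≟_ (witnesses-satisfy ws)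
  count : toℚ (length ns) ≤ x * S
  count = length≤*sumRecip 0≤x ds (All.map proj₁ divisors-hyps) uniq
    (All.map (λ (1≤n , n<x , _) → 1≤n , n<x) hyps)
    (All.map (λ (d , d∈ , d∣n) → d , ∈-deduplicate⁺ ℕ._≟_ d∈ , d∣n) (witnesses-cover ws))

lemma3p3 : Σ ℕ λ C →
  ((x : ℚ) → toℚ 3 ≤ x →
    (ms : List ℕ) → Unique ms →
    All (λ m → 1 ℕ.≤ m × AboveSqrt x m × Friable2logx x m) ms →
    cube (sumRecip ms) * x ≤ cube (toℚ C))
  ×
  ((x : ℚ) → toℚ 3 ≤ x →
    (ns : List ℕ) → Unique ns →
    All (λ n → 1 ℕ.≤ n × toℚ n < x ×
               ∃ λ d → d ∣ n × AboveSqrt x d × Friable2logx x d) ns →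
    cube (toℚ (length ns)) ≤ cube (toℚ C) * (x * x))
lemma3p3 = friableConstant
         , (λ x 3≤x → friable-reciprocal-sum x (≤-trans (≤ᵇ⇒≤ _) 3≤x))
         , (λ x 3≤x → friable-divisor-count x (≤-trans (≤ᵇ⇒≤ _) 3≤x))
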